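{- Let $\mathcal{U}$ be the set of all non-trivial parts that appear in some linear clobber game starting from a part in $\mathcal{A}=\{(\texttt{ox})^n : n\ge 1\}$. Then $\mathcal{U}$ is the set of non-trivial parts belonging to the union of the ten sets $\mathcal{A}=\{(\texttt{ox})^n: n\ge1\}$, $\mathcal{O}=\{(\texttt{ox})^n\texttt{o}: n\ge 0\}$, $o\mathcal{A}=\{\texttt{o}(\texttt{ox})^n: n\ge 0\}$, $o\mathcal{O}=\{\texttt{o}(\texttt{ox})^n\texttt{o}: n\ge 0\}$, $o\mathcal{O}o=\{\texttt{o}(\texttt{ox})^n\texttt{oo}: n\ge 0\}$, $o\mathcal{A}x=\{\texttt{o}(\texttt{ox})^n\texttt{x}: n\ge 1\}$, $-\mathcal{O}$, $-o\mathcal{A}$, $-o\mathcal{O}$, $-o\mathcal{O}o$, where $-S$ denotes the set of color-swapped ($\texttt{x}\leftrightarrow\texttt{o}$) strings of $S$.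
   Context: Linear clobber is a two-player game (Left owns black stones \texttt{x}, Right owns white stones \texttt{o}) played on a path whose cells are empty or hold a stone. On a turn a player takes one of their stones adjacent to an opponent stone and clobbers it: the opponent's stone is removed and the player's stone moves into its cell (leaving its old cell empty). A part is a maximal run of consecutive occupied cells (a connected component), written as a string over $\{\texttt{x},\texttt{o}\}$; a part and its left-right reversal are identified. A part is trivial if no two adjacent stones have different colors (no legal move). A part "appears in a game" if it is a part of some position reachable by a sequence of legal moves (either player moving, in any order) from the starting position. Exponents denote repeated concatenation, e.g. $\texttt{o}(\texttt{ox})^3=\texttt{ooxoxox}$. -}

module Defs where

open import Data.Nat using (ℕ; zero; suc; _≤_)
open import Data.List using (List; []; _∷_; _++_; map; reverse)
open import Data.Maybe using (Maybe; just; nothing)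
open import Data.Product using (Σ; ∃; _×_; _,_)
open import Data.Sum using (_⊎_)
open import Relation.Binary.PropositionalEquality using (_≡_; _≢_)
open import Relation.Binary.Construct.Closure.ReflexiveTransitive using (Star)

-- Stones: x = black (Left), o = white (Right).
data Stone : Set where
  x o : Stone

-- A cell of the path: empty (nothing) or holding a stone.
Cell : Set
Cell = Maybe Stone

Board : Set
Board = List Cell

swap : Stone → Stone
swap x = o
swap o = x

pow : {A : Set} → List A → ℕ → List A
pow u zero    = []
pow u (suc n) = u ++ pow u n

ox : List Stone
ox = o ∷ x ∷ []

data Step : Board → Board → Set where
  clobber-right : ∀ (pre suf : Board) (a b : Stone) → a ≢ b →
    Step (pre ++ just a ∷ just b ∷ suf) (pre ++ nothing ∷ just a ∷ suf)
  clobber-left  : ∀ (pre suf : Board) (a b : Stone) → a ≢ b →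
    Step (pre ++ just a ∷ just b ∷ suf) (pre ++ just b ∷ nothing ∷ suf)

Reachable : Board → Board → Set
Reachable = Star Step

LeftBoundary : Board → Set
LeftBoundary pre = pre ≡ [] ⊎ Σ Board (λ p → pre ≡ p ++ nothing ∷ [])

RightBoundary : Board → Set
RightBoundary suf = suf ≡ [] ⊎ Σ Board (λ s → suf ≡ nothing ∷ s)

-- w (read left to right) is a part (maximal run of occupied cells) of B.
IsPart : List Stone → Board → Set
IsPart w B = (w ≢ []) × Σ Board (λ pre → Σ Board (λ suf →
  (B ≡ pre ++ map just w ++ suf) × LeftBoundary pre × RightBoundary suf))

NonTrivial : List Stone → Set
NonTrivial w = Σ (List Stone) (λ p → Σ (List Stone) (λ q →
  Σ Stone (λ a → Σ Stone (λ b → (a ≢ b) × (w ≡ p ++ a ∷ b ∷ q)))))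

start : ℕ → Board
start n = map just (pow ox n)

-- w (up to reversal) appears in some game starting from a part of 𝒜.
InU : List Stone → Set
InU w = Σ ℕ (λ n → (1 ≤ n) × Σ Board (λ B →
  Reachable (start n) B × (IsPart w B ⊎ IsPart (reverse w) B)))

data Basic : List Stone → Set where
  A-fam   : ∀ n → 1 ≤ n → Basic (pow ox n)
  O-fam   : ∀ n → Basic (pow ox n ++ o ∷ [])
  oA-fam  : ∀ n → Basic (o ∷ pow ox n)
  oO-fam  : ∀ n → Basic (o ∷ pow ox n ++ o ∷ [])
  oOo-fam : ∀ n → Basic (o ∷ pow ox n ++ o ∷ o ∷ [])
  oAx-fam : ∀ n → 1 ≤ n → Basic (o ∷ pow ox n ++ x ∷ [])

-- The four families whose colour-swaps are included.
data Negatable : List Stone → Set where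
  O-neg   : ∀ n → Negatable (pow ox n ++ o ∷ [])
  oA-neg  : ∀ n → Negatable (o ∷ pow ox n)
  oO-neg  : ∀ n → Negatable (o ∷ pow ox n ++ o ∷ [])
  oOo-neg : ∀ n → Negatable (o ∷ pow ox n ++ o ∷ o ∷ [])

InUnion : List Stone → Set
InUnion w = Basic w ⊎ Negatable (map swap w)

module Submission where

-- A move leaves an empty cell next to the only adjacent pair whose colours it can make equal,
-- so no position reachable from (ox)ⁿ has four consecutive stones a b b c.  Hence every part
-- appearing in the game is an alternating word whose first and/or last stone may be doubled;
-- sorting such words by their colours and the parity of their length yields the ten families.
-- Conversely, every word of the ten families is cut out of some (ox)ⁿ by at most two moves.

open import Algebra.Definitions using (Involutive)
open import Data.Empty using (⊥-elim)
open import Data.List as List using (List; []; _∷_; _++_; _∷ʳ_; [_]; map; reverse)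
open import Data.List.Properties
  using (map-++; ++-assoc; ++-identityʳ; ++-conicalʳ; reverse-++; unfold-reverse; reverse-involutive)
open import Data.Maybe using (just; nothing)
open import Data.Nat using (ℕ; zero; suc; _+_; _≤_; s≤s; z≤n)
import Data.Nat.GeneralisedArithmetic as ℕ
open import Data.Nat.Properties using (≤-trans; m≤n+m)
open import Data.Product using (_,_; proj₁)
open import Data.Sum using (_⊎_; inj₁; inj₂)
open import Function.Base using (_∘_)
open import Function.Bundles using (_⇔_; mk⇔)
open import Relation.Binary.Construct.Closure.ReflexiveTransitive using (ε; _◅_)
open import Relation.Binary.PropositionalEquality
  using (_≡_; _≢_; refl; sym; trans; cong; cong₂; subst; module ≡-Reasoning)
open import Relation.Nullary using (¬_)

open import Defs

module _ {A : Set} (f : A → A) where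

  iterate-∷ʳ : ∀ s k → List.iterate f s (suc k) ≡ List.iterate f s k ∷ʳ ℕ.iterate f s k
  iterate-∷ʳ s zero    = refl
  iterate-∷ʳ s (suc k) = cong (s ∷_) (iterate-∷ʳ (f s) k)

  map-iterate : ∀ s k → map f (List.iterate f s k) ≡ List.iterate f (f s) k
  map-iterate s zero    = refl
  map-iterate s (suc k) = cong (f s ∷_) (map-iterate (f s) k)

  iterate-comm : ∀ s k → ℕ.iterate f (f s) k ≡ f (ℕ.iterate f s k)
  iterate-comm s zero    = refl
  iterate-comm s (suc k) = iterate-comm (f s) k

module _ {A : Set} {f : A → A} (f-involutive : Involutive _≡_ f) where

  iterate-involutive : ∀ s k → ℕ.iterate f (ℕ.iterate f s k) k ≡ s
  iterate-involutive s zero    = refl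
  iterate-involutive s (suc k) = begin
    ℕ.iterate f (ℕ.iterate f (f s) k) (suc k) ≡⟨ iterate-comm f _ k ⟩
    f (ℕ.iterate f (ℕ.iterate f (f s) k) k)   ≡⟨ cong f (iterate-involutive (f s) k) ⟩
    f (f s)                                   ≡⟨ f-involutive s ⟩
    s                                         ∎
    where open ≡-Reasoning

  reverse-iterate : ∀ s k →
    reverse (List.iterate f s (suc k)) ≡ List.iterate f (ℕ.iterate f s k) (suc k)
  reverse-iterate s zero    = refl
  reverse-iterate s (suc k) = begin
    reverse (s ∷ List.iterate f (f s) (suc k))        ≡⟨ unfold-reverse s (List.iterate f (f s) (suc k)) ⟩
    reverse (List.iterate f (f s) (suc k)) ∷ʳ s       ≡⟨ cong (_∷ʳ s) (reverse-iterate (f s) k) ⟩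
    List.iterate f t (suc k) ∷ʳ s                     ≡⟨ cong (List.iterate f t (suc k) ∷ʳ_) t-end ⟩
    List.iterate f t (suc k) ∷ʳ ℕ.iterate f t (suc k) ≡⟨ iterate-∷ʳ f t (suc k) ⟨
    List.iterate f t (suc (suc k))                    ∎
    where
    open ≡-Reasoning
    t = ℕ.iterate f (f s) k
    t-end : s ≡ ℕ.iterate f t (suc k)
    t-end = sym (trans (iterate-comm f t k) (trans (cong f (iterate-involutive (f s) k)) (f-involutive s)))

  ∷-reverse-iterate : ∀ s k →
    ℕ.iterate f s k ∷ reverse (List.iterate f s k) ≡ List.iterate f (ℕ.iterate f s k) (suc k)
  ∷-reverse-iterate s k = begin
    ℕ.iterate f s k ∷ reverse (List.iterate f s k)    ≡⟨ reverse-++ (List.iterate f s k) _ ⟨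
    reverse (List.iterate f s k ∷ʳ ℕ.iterate f s k)   ≡⟨ cong reverse (iterate-∷ʳ f s k) ⟨
    reverse (List.iterate f s (suc k))                ≡⟨ reverse-iterate s k ⟩
    List.iterate f (ℕ.iterate f s k) (suc k)          ∎
    where open ≡-Reasoning

  map-involutive : ∀ xs → map f (map f xs) ≡ xs
  map-involutive []       = refl
  map-involutive (a ∷ as) = cong₂ _∷_ (f-involutive a) (map-involutive as)

module _ {A : Set} where

  pow-+ : ∀ (u : List A) m n → pow u (m + n) ≡ pow u m ++ pow u n
  pow-+ u zero    n = refl
  pow-+ u (suc m) n = trans (cong (u ++_) (pow-+ u m n)) (sym (++-assoc u (pow u m) (pow u n)))

  pow-suc-++ : ∀ (u : List A) n → pow u (suc n) ≡ pow u n ++ u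
  pow-suc-++ u zero    = ++-identityʳ u
  pow-suc-++ u (suc n) = trans (cong (u ++_) (pow-suc-++ u n)) (sym (++-assoc u (pow u n) u))

  map-pow : ∀ {B : Set} (f : A → B) u n → map f (pow u n) ≡ pow (map f u) n
  map-pow f u zero    = refl
  map-pow f u (suc n) = trans (map-++ f u (pow u n)) (cong (map f u ++_) (map-pow f u n))

  reverse-pow : ∀ (u : List A) n → reverse (pow u n) ≡ pow (reverse u) n
  reverse-pow u zero    = refl
  reverse-pow u (suc n) = begin
    reverse (u ++ pow u n)           ≡⟨ reverse-++ u (pow u n) ⟩
    reverse (pow u n) ++ reverse u   ≡⟨ cong (_++ reverse u) (reverse-pow u n) ⟩
    pow (reverse u) n ++ reverse u   ≡⟨ pow-suc-++ (reverse u) n ⟨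
    pow (reverse u) (suc n)          ∎
    where open ≡-Reasoning

  map-++-assoc : ∀ {B : Set} (f : A → B) xs ys zs → map f (xs ++ ys) ++ zs ≡ map f xs ++ map f ys ++ zs
  map-++-assoc f xs ys zs = trans (cong (_++ zs) (map-++ f xs ys)) (++-assoc (map f xs) (map f ys) zs)

  ∷ʳ≢[] : ∀ (xs : List A) y → xs ∷ʳ y ≢ []
  ∷ʳ≢[] xs y eq with () ← ++-conicalʳ xs [ y ] eq

swap-involutive : Involutive _≡_ swap
swap-involutive x = refl
swap-involutive o = refl

x≢o : x ≢ o
x≢o ()

o≢x : o ≢ x
o≢x ()

reverse-pow-ox : ∀ n → reverse (pow ox n) ≡ map swap (pow ox n)
reverse-pow-ox n = trans (reverse-pow ox n) (sym (map-pow swap ox n))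

alternating : Stone → ℕ → List Stone
alternating = List.iterate swap

colourAt : Stone → ℕ → Stone
colourAt = ℕ.iterate swap

alternating-doubled : Stone → ℕ → List Stone
alternating-doubled s k = alternating s k ++ colourAt s k ∷ colourAt s k ∷ []

-- The invariant: no repeated colour strictly inside a run of stones

data InnerRepeat {A : Set} : List A → Set where
  here  : ∀ a b c r → InnerRepeat (a ∷ b ∷ b ∷ c ∷ r)
  there : ∀ c {r} → InnerRepeat r → InnerRepeat (c ∷ r)

data OccupiedRepeat : Board → Set where
  here  : ∀ a b c r → OccupiedRepeat (just a ∷ just b ∷ just b ∷ just c ∷ r)
  there : ∀ c {r} → OccupiedRepeat r → OccupiedRepeat (c ∷ r)

OccupiedRepeat-++⁺ʳ : ∀ pre {r} → OccupiedRepeat r → OccupiedRepeat (pre ++ r)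
OccupiedRepeat-++⁺ʳ []        rep = rep
OccupiedRepeat-++⁺ʳ (c ∷ pre) rep = there c (OccupiedRepeat-++⁺ʳ pre rep)

OccupiedRepeat-map-just : ∀ {w} suf → InnerRepeat w → OccupiedRepeat (map just w ++ suf)
OccupiedRepeat-map-just suf (here a b c r) = here a b c _
OccupiedRepeat-map-just suf (there c rep)  = there _ (OccupiedRepeat-map-just suf rep)

clobber-right-reflects : ∀ pre suf a b →
  OccupiedRepeat (pre ++ nothing ∷ just a ∷ suf) → OccupiedRepeat (pre ++ just a ∷ just b ∷ suf)
clobber-right-reflects [] suf a b (there _ (here _ c d r))  = there _ (here b c d r)
clobber-right-reflects [] suf a b (there _ (there _ rep))   = there _ (there _ rep)
clobber-right-reflects (c ∷ []) suf a b (there _ rep) = there c (clobber-right-reflects [] suf a b rep)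
clobber-right-reflects (c ∷ d ∷ []) suf a b (there _ rep) =
  there c (clobber-right-reflects (d ∷ []) suf a b rep)
clobber-right-reflects (c ∷ d ∷ e ∷ []) suf a b (there _ rep) =
  there c (clobber-right-reflects (d ∷ e ∷ []) suf a b rep)
clobber-right-reflects (c ∷ pre@(_ ∷ _ ∷ _ ∷ _)) suf a b (there _ rep) =
  there c (clobber-right-reflects pre suf a b rep)
clobber-right-reflects (_ ∷ _ ∷ _ ∷ _ ∷ pre) suf a b (here c d e _) = here c d e _

clobber-left-reflects : ∀ pre suf a b →
  OccupiedRepeat (pre ++ just b ∷ nothing ∷ suf) → OccupiedRepeat (pre ++ just a ∷ just b ∷ suf)
clobber-left-reflects [] suf a b (there _ (there _ rep)) = there _ (there _ rep)
clobber-left-reflects (c ∷ []) suf a b (there _ rep) = there c (clobber-left-reflects [] suf a b rep)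
clobber-left-reflects (c ∷ d ∷ []) suf a b (there _ rep) =
  there c (clobber-left-reflects (d ∷ []) suf a b rep)
clobber-left-reflects (c ∷ d ∷ e ∷ []) suf a b (there _ rep) =
  there c (clobber-left-reflects (d ∷ e ∷ []) suf a b rep)
clobber-left-reflects (c ∷ pre@(_ ∷ _ ∷ _ ∷ _)) suf a b (there _ rep) =
  there c (clobber-left-reflects pre suf a b rep)
clobber-left-reflects (_ ∷ _ ∷ _ ∷ []) suf a b (here c d e _) = here c d a _
clobber-left-reflects (_ ∷ _ ∷ _ ∷ _ ∷ pre) suf a b (here c d e _) = here c d e _

Reachable-reflects-repeat : ∀ {B B′} → Reachable B B′ → OccupiedRepeat B′ → OccupiedRepeat B
Reachable-reflects-repeat ε rep = rep
Reachable-reflects-repeat (clobber-right pre suf a b _ ◅ moves) rep =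
  clobber-right-reflects pre suf a b (Reachable-reflects-repeat moves rep)
Reachable-reflects-repeat (clobber-left pre suf a b _ ◅ moves) rep =
  clobber-left-reflects pre suf a b (Reachable-reflects-repeat moves rep)

start-repeat-free : ∀ n → ¬ OccupiedRepeat (start n)
start-repeat-free (suc zero)    (there _ (there _ ()))
start-repeat-free (suc (suc n)) (there _ (there _ rep)) = start-repeat-free (suc n) rep

appearing-part-repeat-free : ∀ n {B w} → Reachable (start n) B → IsPart w B → ¬ InnerRepeat w
appearing-part-repeat-free n moves (_ , pre , suf , refl , _ , _) rep =
  start-repeat-free n
    (Reachable-reflects-repeat moves (OccupiedRepeat-++⁺ʳ pre (OccupiedRepeat-map-just suf rep)))

-- Repeat-free words are almost alternating

data AlmostAlternating : List Stone → Set where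
  plain        : ∀ s k → AlmostAlternating (alternating s k)
  doubled-head : ∀ s k → AlmostAlternating (s ∷ alternating s k)
  doubled-last : ∀ s k → AlmostAlternating (alternating-doubled s k)
  doubled-both : ∀ s k → AlmostAlternating (s ∷ alternating-doubled s k)

∷-alternating : ∀ a s k → AlmostAlternating (a ∷ alternating s k)
∷-alternating x x k = doubled-head x k
∷-alternating o o k = doubled-head o k
∷-alternating x o k = plain x (suc k)
∷-alternating o x k = plain o (suc k)

∷-alternating-doubled : ∀ a s k → AlmostAlternating (a ∷ alternating-doubled s k)
∷-alternating-doubled x x k = doubled-both x k
∷-alternating-doubled o o k = doubled-both o k
∷-alternating-doubled x o k = doubled-last x (suc k)
∷-alternating-doubled o x k = doubled-last o (suc k)

∷-almostAlternating : ∀ a {w} → AlmostAlternating w → ¬ InnerRepeat (a ∷ w) →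
                      AlmostAlternating (a ∷ w)
∷-almostAlternating a (plain s k)                    _  = ∷-alternating a s k
∷-almostAlternating a (doubled-head s zero)          _  = ∷-alternating a s 1
∷-almostAlternating a (doubled-head s (suc zero))    _  = ∷-alternating-doubled a s 0
∷-almostAlternating a (doubled-head s (suc (suc k))) nr = ⊥-elim (nr (here a s _ _))
∷-almostAlternating a (doubled-last s k)             _  = ∷-alternating-doubled a s k
∷-almostAlternating a (doubled-both s zero)          nr = ⊥-elim (nr (here a s s _))
∷-almostAlternating a (doubled-both s (suc zero))    nr = ⊥-elim (nr (here a s _ _))
∷-almostAlternating a (doubled-both s (suc (suc k))) nr = ⊥-elim (nr (here a s _ _))

repeat-free⇒almostAlternating : ∀ w → ¬ InnerRepeat w → AlmostAlternating w
repeat-free⇒almostAlternating []      _  = plain o 0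
repeat-free⇒almostAlternating (a ∷ w) nr =
  ∷-almostAlternating a (repeat-free⇒almostAlternating w (nr ∘ there a)) nr

-- Almost alternating words lie in the ten families

InUnionOrReverse : List Stone → Set
InUnionOrReverse w = InUnion w ⊎ InUnion (reverse w)

InUnionOrReverse-reverse : ∀ w → InUnionOrReverse (reverse w) → InUnionOrReverse w
InUnionOrReverse-reverse w (inj₁ u) = inj₂ u
InUnionOrReverse-reverse w (inj₂ u) = inj₁ (subst InUnion (reverse-involutive w) u)

data Parity (k : ℕ) : Set where
  even : ∀ n → alternating o k ≡ pow ox n      → colourAt o k ≡ o → Parity k
  odd  : ∀ n → alternating o k ≡ pow ox n ∷ʳ o → colourAt o k ≡ x → Parity k

parity : ∀ k → Parity k
parity zero       = even 0 refl refl
parity (suc zero) = odd 0 refl refl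
parity (suc (suc k)) with parity k
... | even n e c = even (suc n) (cong (λ w → o ∷ x ∷ w) e) c
... | odd  n e c = odd  (suc n) (cong (λ w → o ∷ x ∷ w) e) c

alternating-x-swap : ∀ k → map swap (alternating x k) ≡ alternating o k
alternating-x-swap = map-iterate swap x

plain-classified : ∀ s k → alternating s k ≢ [] → InUnionOrReverse (alternating s k)
plain-classified o k nonempty with parity k
... | even zero    e _ = ⊥-elim (nonempty e)
... | even (suc n) e _ = inj₁ (inj₁ (subst Basic (sym e) (A-fam (suc n) (s≤s z≤n))))
... | odd  n       e _ = inj₁ (inj₁ (subst Basic (sym e) (O-fam n)))
plain-classified x zero    nonempty = ⊥-elim (nonempty refl)
plain-classified x (suc k) _ with parity (suc k)
... | odd  n       e _ =
  inj₁ (inj₂ (subst Negatable (sym (trans (alternating-x-swap (suc k)) e)) (O-neg n)))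
... | even (suc n) e c = inj₂ (inj₁ (subst Basic (sym reversed) (A-fam (suc n) (s≤s z≤n))))
  where
  reversed : reverse (alternating x (suc k)) ≡ pow ox (suc n)
  reversed = trans (reverse-iterate swap-involutive x k)
                   (trans (cong (λ s → alternating s (suc k)) c) e)

doubled-head-classified : ∀ s k → InUnion (s ∷ alternating s k)
doubled-head-classified o k with parity k
... | even n e _ = inj₁ (subst Basic (cong (o ∷_) (sym e)) (oA-fam n))
... | odd  n e _ = inj₁ (subst Basic (cong (o ∷_) (sym e)) (oO-fam n))
doubled-head-classified x k with parity k
... | even n e _ = inj₂ (subst Negatable (cong (o ∷_) (sym (trans (alternating-x-swap k) e))) (oA-neg n))
... | odd  n e _ = inj₂ (subst Negatable (cong (o ∷_) (sym (trans (alternating-x-swap k) e))) (oO-neg n))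

reverse-alternating-doubled : ∀ s k →
  reverse (alternating-doubled s k) ≡ colourAt s k ∷ alternating (colourAt s k) (suc k)
reverse-alternating-doubled s k =
  trans (reverse-++ (alternating s k) (c ∷ c ∷ []))
        (cong (c ∷_) (∷-reverse-iterate swap-involutive s k))
  where c = colourAt s k

doubled-last-classified : ∀ s k → InUnion (reverse (alternating-doubled s k))
doubled-last-classified s k =
  subst InUnion (sym (reverse-alternating-doubled s k)) (doubled-head-classified (colourAt s k) (suc k))

map-swap-alternating-doubled : ∀ s k →
  map swap (alternating-doubled s k) ≡ alternating-doubled (swap s) k
map-swap-alternating-doubled s k = trans (map-++ swap (alternating s k) (c ∷ c ∷ []))
  (cong₂ _++_ (map-iterate swap s k) (cong (λ c → c ∷ c ∷ []) (sym (iterate-comm swap s k))))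
  where c = colourAt s k

reverse-doubled-both : ∀ s k →
  reverse (s ∷ alternating-doubled s k) ≡ colourAt s k ∷ alternating-doubled (colourAt s k) k
reverse-doubled-both s k = begin
  reverse (s ∷ alternating-doubled s k)      ≡⟨ unfold-reverse s (alternating-doubled s k) ⟩
  reverse (alternating-doubled s k) ∷ʳ s     ≡⟨ cong (_∷ʳ s) (reverse-alternating-doubled s k) ⟩
  c ∷ alternating c (suc k) ∷ʳ s             ≡⟨ cong (λ w → c ∷ w ∷ʳ s) (iterate-∷ʳ swap c k) ⟩
  c ∷ (alternating c k ∷ʳ colourAt c k) ∷ʳ s ≡⟨ cong (c ∷_) (++-assoc (alternating c k) _ _) ⟩
  c ∷ alternating c k ++ colourAt c k ∷ s ∷ [] ≡⟨ cong (λ t → c ∷ alternating c k ++ colourAt c k ∷ t ∷ []) s≡cc ⟩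
  c ∷ alternating-doubled c k                ∎
  where
  open ≡-Reasoning
  c = colourAt s k
  s≡cc : s ≡ colourAt c k
  s≡cc = sym (iterate-involutive swap-involutive s k)

ox-then-xx : ∀ n → (pow ox n ∷ʳ o) ++ x ∷ x ∷ [] ≡ pow ox (suc n) ∷ʳ x
ox-then-xx zero    = refl
ox-then-xx (suc n) = cong (λ w → o ∷ x ∷ w) (ox-then-xx n)

doubled-both-o-classified : ∀ k → Basic (o ∷ alternating-doubled o k)
doubled-both-o-classified k with parity k
... | even n e c = subst Basic (cong₂ (λ w c → o ∷ w ++ c ∷ c ∷ []) (sym e) (sym c)) (oOo-fam n)
... | odd  n e c = subst Basic (sym (begin
  o ∷ alternating-doubled o k       ≡⟨ cong₂ (λ w c → o ∷ w ++ c ∷ c ∷ []) e c ⟩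
  o ∷ (pow ox n ∷ʳ o) ++ x ∷ x ∷ [] ≡⟨ cong (o ∷_) (ox-then-xx n) ⟩
  o ∷ pow ox (suc n) ∷ʳ x           ∎)) (oAx-fam (suc n) (s≤s z≤n))
  where open ≡-Reasoning

doubled-both-classified : ∀ s k → InUnionOrReverse (s ∷ alternating-doubled s k)
doubled-both-classified o k = inj₁ (inj₁ (doubled-both-o-classified k))
doubled-both-classified x k with parity k
... | even n e c = inj₁ (inj₂ (subst Negatable (sym swapped) (oOo-neg n)))
  where
  swapped : o ∷ map swap (alternating-doubled x k) ≡ o ∷ pow ox n ++ o ∷ o ∷ []
  swapped = trans (cong (o ∷_) (map-swap-alternating-doubled x k))
                  (cong₂ (λ w c → o ∷ w ++ c ∷ c ∷ []) e c)
... | odd n _ c = inj₂ (inj₁ (subst Basic (sym reversed) (doubled-both-o-classified k)))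
  where
  colourAt-x : colourAt x k ≡ o
  colourAt-x = trans (iterate-comm swap o k) (cong swap c)
  reversed : reverse (x ∷ alternating-doubled x k) ≡ o ∷ alternating-doubled o k
  reversed = trans (reverse-doubled-both x k) (cong (λ s → s ∷ alternating-doubled s k) colourAt-x)

almostAlternating-classified : ∀ {w} → AlmostAlternating w → w ≢ [] → InUnionOrReverse w
almostAlternating-classified (plain s k)        nonempty = plain-classified s k nonempty
almostAlternating-classified (doubled-head s k) _        = inj₁ (doubled-head-classified s k)
almostAlternating-classified (doubled-last s k) _        = inj₂ (doubled-last-classified s k)
almostAlternating-classified (doubled-both s k) _        = doubled-both-classified s k

InU⇒InUnionOrReverse : ∀ w → InU w → InUnionOrReverse w
InU⇒InUnionOrReverse w (n , _ , _ , moves , inj₁ part) =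
  almostAlternating-classified
    (repeat-free⇒almostAlternating w (appearing-part-repeat-free n moves part)) (proj₁ part)
InU⇒InUnionOrReverse w (n , _ , _ , moves , inj₂ part) = InUnionOrReverse-reverse w
  (almostAlternating-classified
    (repeat-free⇒almostAlternating (reverse w) (appearing-part-repeat-free n moves part)) (proj₁ part))

-- Every word of the ten families appears

appears : ∀ m → 1 ≤ m → ∀ {B} pre {w} suf → Reachable (start m) B → B ≡ pre ++ map just w ++ suf →
          w ≢ [] → LeftBoundary pre → RightBoundary suf → InU w
appears m 1≤m pre suf moves eq nonempty left right =
  m , 1≤m , _ , moves , inj₁ (nonempty , pre , suf , eq , left , right)

reverse-InU : ∀ {w} → InU w → InU (reverse w)
reverse-InU {w} (m , 1≤m , B , moves , inj₁ part) =
  m , 1≤m , B , moves , inj₂ (subst (λ v → IsPart v B) (sym (reverse-involutive w)) part)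
reverse-InU (m , 1≤m , B , moves , inj₂ part) = m , 1≤m , B , moves , inj₁ part

InU-reverse : ∀ w → InU (reverse w) → InU w
InU-reverse w u = subst InU (reverse-involutive w) (reverse-InU u)

clobber-right-at : ∀ {B} pre suf a b → a ≢ b → B ≡ pre ++ just a ∷ just b ∷ suf →
                   Step B (pre ++ nothing ∷ just a ∷ suf)
clobber-right-at pre suf a b a≢b refl = clobber-right pre suf a b a≢b

clobber-left-at : ∀ {B} pre suf a b → a ≢ b → B ≡ pre ++ just a ∷ just b ∷ suf →
                  Step B (pre ++ just b ∷ nothing ∷ suf)
clobber-left-at pre suf a b a≢b refl = clobber-left pre suf a b a≢b

cells : List Stone → Board
cells = map just

start-+ : ∀ m n → start (m + n) ≡ cells (pow ox m) ++ start n
start-+ m n = trans (cong cells (pow-+ ox m n)) (map-++ just (pow ox m) (pow ox n))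

start-ends-oxox : ∀ n → start (n + 2) ≡ cells (pow ox n ∷ʳ o) ++ just x ∷ just o ∷ just x ∷ []
start-ends-oxox n = trans (start-+ n 2) (sym (map-++-assoc just (pow ox n) [ o ] _))

at-end : ∀ (w : List Stone) → cells w ≡ cells w ++ []
at-end w = sym (++-identityʳ (cells w))

1≤n+2 : ∀ n → 1 ≤ n + 2
1≤n+2 n = ≤-trans (s≤s z≤n) (m≤n+m 2 n)

A-appears : ∀ n → InU (pow ox (suc n))
A-appears n = appears (suc n) (s≤s z≤n) [] [] ε (at-end (pow ox (suc n))) (λ ()) (inj₁ refl) (inj₁ refl)

O-appears : ∀ n → InU (pow ox n ∷ʳ o)
O-appears n = appears (n + 2) (1≤n+2 n) [] (nothing ∷ just x ∷ just x ∷ [])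
  (clobber-right-at (cells (pow ox n ∷ʳ o)) _ x o x≢o (start-ends-oxox n) ◅ ε)
  refl (∷ʳ≢[] (pow ox n) o) (inj₁ refl) (inj₂ (_ , refl))

oA-appears : ∀ n → InU (o ∷ pow ox n)
oA-appears n = appears (suc n) (s≤s z≤n) (nothing ∷ []) []
  (clobber-right [] (cells (pow ox n)) o x o≢x ◅ ε)
  (cong (nothing ∷_) (at-end (o ∷ pow ox n))) (λ ()) (inj₂ ([] , refl)) (inj₁ refl)

oO-appears : ∀ n → InU (o ∷ pow ox n ∷ʳ o)
oO-appears n = appears (suc (n + 2)) (s≤s z≤n) (nothing ∷ []) (nothing ∷ just x ∷ just x ∷ [])
  (clobber-right [] (start (n + 2)) o x o≢x ◅
   clobber-right-at (nothing ∷ just o ∷ cells (pow ox n ∷ʳ o)) _ x o x≢o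
     (cong (λ B → nothing ∷ just o ∷ B) (start-ends-oxox n)) ◅ ε)
  refl (λ ()) (inj₂ ([] , refl)) (inj₂ (_ , refl))

oOo-appears : ∀ n → InU (o ∷ pow ox n ++ o ∷ o ∷ [])
oOo-appears n = appears (suc (n + 2)) (s≤s z≤n) (nothing ∷ []) (nothing ∷ just x ∷ [])
  (clobber-right [] (start (n + 2)) o x o≢x ◅
   clobber-left-at (nothing ∷ just o ∷ cells (pow ox n ∷ʳ o)) _ x o x≢o
     (cong (λ B → nothing ∷ just o ∷ B) (start-ends-oxox n)) ◅ ε)
  (cong (λ B → nothing ∷ just o ∷ B)
    (trans (map-++-assoc just (pow ox n) [ o ] _) (sym (map-++-assoc just (pow ox n) (o ∷ o ∷ []) _))))
  (λ ()) (inj₂ ([] , refl)) (inj₂ (_ , refl))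

oAx-appears : ∀ n → InU (o ∷ pow ox n ∷ʳ x)
oAx-appears n = appears (suc (n + 1)) (s≤s z≤n) (nothing ∷ []) (nothing ∷ [])
  (clobber-right [] (start (n + 1)) o x o≢x ◅
   clobber-left-at (nothing ∷ just o ∷ cells (pow ox n)) [] o x o≢x
     (cong (λ B → nothing ∷ just o ∷ B) (start-+ n 1)) ◅ ε)
  (cong (λ B → nothing ∷ just o ∷ B) (sym (map-++-assoc just (pow ox n) [ x ] _)))
  (λ ()) (inj₂ ([] , refl)) (inj₂ (_ , refl))

Basic⇒InU : ∀ {w} → Basic w → InU w
Basic⇒InU (A-fam (suc n) _) = A-appears n
Basic⇒InU (O-fam n)         = O-appears n
Basic⇒InU (oA-fam n)        = oA-appears n
Basic⇒InU (oO-fam n)        = oO-appears n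
Basic⇒InU (oOo-fam n)       = oOo-appears n
Basic⇒InU (oAx-fam n _)     = oAx-appears n

swap-O : ∀ n → map swap (pow ox n ∷ʳ o) ≡ x ∷ pow ox n
swap-O zero    = refl
swap-O (suc n) = cong (λ w → x ∷ o ∷ w) (swap-O n)

swap-Oo : ∀ n → map swap (pow ox n ++ o ∷ o ∷ []) ≡ x ∷ pow ox n ∷ʳ x
swap-Oo zero    = refl
swap-Oo (suc n) = cong (λ w → x ∷ o ∷ w) (swap-Oo n)

-O-appears : ∀ n → InU (map swap (pow ox n ∷ʳ o))
-O-appears n = subst InU (sym (swap-O n))
  (appears (2 + n) (s≤s z≤n) (just o ∷ just o ∷ nothing ∷ []) []
  (clobber-left (just o ∷ []) (just x ∷ cells (pow ox n)) x o x≢o ◅ ε)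
  (cong (λ B → just o ∷ just o ∷ nothing ∷ B) (at-end (x ∷ pow ox n)))
  (λ ()) (inj₂ (just o ∷ just o ∷ [] , refl)) (inj₁ refl))

-oA-appears : ∀ n → InU (map swap (o ∷ pow ox n))
-oA-appears n = subst InU (sym swapped) (reverse-InU (appears (n + 1) (m≤n+m 1 n) [] (nothing ∷ [])
  (clobber-left-at (cells (pow ox n)) [] o x o≢x (start-+ n 1) ◅ ε)
  (sym (map-++-assoc just (pow ox n) [ x ] _)) (∷ʳ≢[] (pow ox n) x) (inj₁ refl) (inj₂ (_ , refl))))
  where
  swapped : map swap (o ∷ pow ox n) ≡ reverse (pow ox n ∷ʳ x)
  swapped = trans (cong (x ∷_) (sym (reverse-pow-ox n))) (sym (reverse-++ (pow ox n) [ x ]))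

-oO-appears : ∀ n → InU (map swap (o ∷ pow ox n ∷ʳ o))
-oO-appears n = subst InU (sym (cong (x ∷_) (swap-O n)))
  (appears (2 + n) (s≤s z≤n) (just o ∷ nothing ∷ []) []
  (clobber-right (just o ∷ []) (just x ∷ cells (pow ox n)) x o x≢o ◅ ε)
  (cong (λ B → just o ∷ nothing ∷ B) (at-end (x ∷ x ∷ pow ox n)))
  (λ ()) (inj₂ (just o ∷ [] , refl)) (inj₁ refl))

-oOo-appears : ∀ n → InU (map swap (o ∷ pow ox n ++ o ∷ o ∷ []))
-oOo-appears n = subst InU (sym (cong (x ∷_) (swap-Oo n)))
  (appears (2 + (n + 1)) (s≤s z≤n) (just o ∷ nothing ∷ []) (nothing ∷ [])
  (clobber-right (just o ∷ []) (just x ∷ start (n + 1)) x o x≢o ◅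
   clobber-left-at (just o ∷ nothing ∷ just x ∷ just x ∷ cells (pow ox n)) [] o x o≢x
     (cong (λ B → just o ∷ nothing ∷ just x ∷ just x ∷ B) (start-+ n 1)) ◅ ε)
  (cong (λ B → just o ∷ nothing ∷ just x ∷ just x ∷ B) (sym (map-++-assoc just (pow ox n) [ x ] _)))
  (λ ()) (inj₂ (just o ∷ [] , refl)) (inj₂ (_ , refl)))

Negatable⇒InU : ∀ {v} → Negatable v → InU (map swap v)
Negatable⇒InU (O-neg n)   = -O-appears n
Negatable⇒InU (oA-neg n)  = -oA-appears n
Negatable⇒InU (oO-neg n)  = -oO-appears n
Negatable⇒InU (oOo-neg n) = -oOo-appears n

InUnion⇒InU : ∀ {w} → InUnion w → InU w
InUnion⇒InU     (inj₁ basic)     = Basic⇒InU basic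
InUnion⇒InU {w} (inj₂ negatable) = subst InU (map-involutive swap-involutive w) (Negatable⇒InU negatable)

InUnionOrReverse⇒InU : ∀ w → InUnionOrReverse w → InU w
InUnionOrReverse⇒InU w (inj₁ u) = InUnion⇒InU u
InUnionOrReverse⇒InU w (inj₂ u) = InU-reverse w (InUnion⇒InU u)

theorem1 : (w : List Stone) → NonTrivial w →
    (InU w ⇔ (InUnion w ⊎ InUnion (reverse w)))
theorem1 w _ = mk⇔ (InU⇒InUnionOrReverse w) (InUnionOrReverse⇒InU w)
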